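{- Let $D$ be a double star with sides $U$ and $V$ and centers $u\in U$ and $v\in V$, and let $G$ be a partial distance graph of $D$. Assume that $C\subsetneq U\setminus\{u\}$ is a connected component of $G[U]$, and that there exists a vertex $v'\in V\setminus\{v\}$ such that no edge of $G$ joins $v'$ to a vertex of $C$. Then $G$ is a partial distance graph of a real caterpillar (on the same vertex set).
   Context: For disjoint vertex sets $U,V$ with $u\in U$, $v\in V$, the double star with sides $U,V$ and centers $u,v$ is the tree on $U\cup V$ whose edges are $uv$, all $uu'$ with $u'\in U\setminus\{u\}$, and all $vv'$ with $v'\in V\setminus\{v\}$. A real caterpillar is a tree with exactly three vertices of degree at least $2$. For a tree $T$ and a graph $G$ on the same vertex set whose edges carry positive integer weights, $G$ is a partial distance graph of $T$ if the weight of every edge $xy$ of $G$ equals the distance of $x$ and $y$ in $T$. $G[U]$ denotes the subgraph of $G$ induced by $U$; components are vertex sets of connected components. -}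

module Defs where

open import Data.Nat using (ℕ; zero; suc; _≤_; _+_)
open import Data.Fin using (Fin; zero; suc; inject₁; fromℕ; _≟_)
open import Data.Bool using (Bool; true; false; _∧_; _∨_; not)
open import Data.Product using (Σ; ∃; _×_; _,_)
open import Data.Sum using (_⊎_)
open import Relation.Binary.PropositionalEquality using (_≡_; _≢_)
open import Relation.Nullary using (¬_)
open import Relation.Nullary.Decidable using (⌊_⌋)
open import Function.Definitions using (Injective)

Graph : ℕ → Set
Graph n = Fin n → Fin n → Bool

module _ {n : ℕ} where

  Edge : Graph n → Fin n → Fin n → Set
  Edge E x y = E x y ≡ true

  IsSimple : Graph n → Set
  IsSimple E = (∀ x y → E x y ≡ E y x) × (∀ x → E x x ≡ false)

  data Walk (E : Graph n) : Fin n → Fin n → ℕ → Set where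
    nil  : ∀ {x} → Walk E x x zero
    cons : ∀ {x y z k} → Edge E x y → Walk E y z k → Walk E x z (suc k)

  Connected : Graph n → Set
  Connected E = ∀ x y → ∃ λ k → Walk E x y k

  Dist : Graph n → Fin n → Fin n → ℕ → Set
  Dist E x y d = Walk E x y d × (∀ k → Walk E x y k → d ≤ k)

  -- a cycle of length k+3: distinct vertices f 0, …, f (k+2), cyclically adjacent
  Cycle : Graph n → ℕ → Set
  Cycle E k = Σ (Fin (suc (suc (suc k))) → Fin n) λ f →
      Injective _≡_ _≡_ f
    × (∀ (i : Fin (suc (suc k))) → Edge E (f (inject₁ i)) (f (suc i)))
    × Edge E (f (fromℕ (suc (suc k)))) (f zero)

  Acyclic : Graph n → Set
  Acyclic E = ∀ k → ¬ Cycle E k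

  IsTree : Graph n → Set
  IsTree E = IsSimple E × Connected E × Acyclic E

  DegGe2 : Graph n → Fin n → Set
  DegGe2 E x = Σ (Fin n) λ y → Σ (Fin n) λ z → y ≢ z × Edge E x y × Edge E x z

  IsRealCaterpillar : Graph n → Set
  IsRealCaterpillar E = IsTree E ×
    (Σ (Fin n) λ a → Σ (Fin n) λ b → Σ (Fin n) λ c →
        a ≢ b × a ≢ c × b ≢ c
      × DegGe2 E a × DegGe2 E b × DegGe2 E c
      × (∀ x → DegGe2 E x → x ≡ a ⊎ x ≡ b ⊎ x ≡ c))

  -- side x ≡ true means x ∈ U, side x ≡ false means x ∈ V
  -- (so U, V are disjoint and cover the vertex set).
  -- Double star with sides U, V and centers u ∈ U, v ∈ V.
  doubleStar : (side : Fin n → Bool) (u v : Fin n) → Graph n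
  doubleStar side u v x y =
       (⌊ x ≟ u ⌋ ∧ ⌊ y ≟ v ⌋) ∨ (⌊ x ≟ v ⌋ ∧ ⌊ y ≟ u ⌋)
    ∨ (⌊ x ≟ u ⌋ ∧ side y ∧ not ⌊ y ≟ u ⌋)
    ∨ (⌊ y ≟ u ⌋ ∧ side x ∧ not ⌊ x ≟ u ⌋)
    ∨ (⌊ x ≟ v ⌋ ∧ not (side y) ∧ not ⌊ y ≟ v ⌋)
    ∨ (⌊ y ≟ v ⌋ ∧ not (side x) ∧ not ⌊ x ≟ v ⌋)

  IsPartialDistanceGraph : Graph n → Graph n → (Fin n → Fin n → ℕ) → Set
  IsPartialDistanceGraph T G w = ∀ x y → Edge G x y → Dist T x y (w x y)

  induced : Graph n → (Fin n → Bool) → Graph n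
  induced G U x y = G x y ∧ U x ∧ U y

  IsComponentOf : Graph n → (Fin n → Bool) → (Fin n → Bool) → Set
  IsComponentOf G U C =
      (∀ x → C x ≡ true → U x ≡ true)
    × (Σ (Fin n) λ x → C x ≡ true)
    × (∀ x y → C x ≡ true → C y ≡ true → ∃ λ k → Walk (induced G U) x y k)
    × (∀ x y → C x ≡ true → Edge (induced G U) x y → C y ≡ true)

{-# OPTIONS --safe #-}
-- Sort the vertices into six kinds: u, v, v′, the component C, A = U ∖ (C ∪ {u}) and
-- B = V ∖ {v, v′}. The caterpillar T has spine u – v – v′ with A hung at u, B at v and C
-- at v′; it is the double star D with C moved from u to v′. Both D and T are pulled back
-- along the kind map from graphs on the six kinds, in which the fibres of the spine kinds
-- are single vertices. So the distance of two distinct vertices is the least length of a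
-- nonempty walk between their kinds, realised by a walk with inner vertices on the spine,
-- and it can be computed on the kinds. D and T agree except between C and u, A or v′, and
-- G has no such edges: C is a component of G[U] avoiding u and A, and v′ has no
-- neighbour in C.
module Submission where

open import Defs
open import Data.Nat using (ℕ; zero; suc; _<_; _≤_; _≤?_; s≤s)
open import Data.Nat.Properties using (≤-antisym; ≰⇒>; anyUpTo?; allUpTo?)
open import Data.Fin using (Fin; _≟_; fromℕ; #_)
open import Data.Fin.Properties using (any?; all?)
open import Data.Bool using (Bool; true; false)
open import Data.Bool.Properties using () renaming (_≟_ to _≟ᵇ_)
open import Data.Product using (Σ; ∃; ∃-syntax; _×_; _,_; proj₁; proj₂)
open import Data.Sum using (_⊎_; inj₁; inj₂)
import Data.Sum as Sum
open import Function using (_∘_; _on_; case_of_)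
open import Relation.Nullary using (¬_; Dec; yes; no; ¬?; contradiction)
open import Relation.Nullary.Decidable
  using (⌊_⌋; isYes≗does; map′; _×-dec_; _⊎-dec_; _→-dec_; from-yes; dec-true; dec-false)
open import Relation.Binary.PropositionalEquality using (_≡_; _≢_; refl; sym; trans; subst)

private variable
  m n k : ℕ

walk? : (R : Graph m) → ∀ k s t → Dec (Walk R s t k)
walk? R zero s t = map′ (λ { refl → nil }) (λ { nil → refl }) (s ≟ t)
walk? R (suc k) s t =
  map′ (λ (z , e , w) → cons e w) (λ { (cons e w) → _ , e , w })
       (any? λ z → (R s z ≟ᵇ true) ×-dec walk? R k z t)

-- walks of length suc k from s to t whose inner vertices satisfy P
WalkThrough : Graph m → (Fin m → Set) → ℕ → Fin m → Fin m → Set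
WalkThrough R P zero    s t = Edge R s t
WalkThrough R P (suc k) s t = ∃[ z ] (P z × Edge R s z × WalkThrough R P k z t)

walkThrough? : (R : Graph m) {P : Fin m → Set} → (∀ z → Dec (P z)) →
               ∀ k s t → Dec (WalkThrough R P k s t)
walkThrough? R P? zero    s t = R s t ≟ᵇ true
walkThrough? R P? (suc k) s t =
  any? λ z → P? z ×-dec (R s z ≟ᵇ true) ×-dec walkThrough? R P? k z t

-- suc k is the least length of a nonempty walk from s to t, and is attained through P
ShortestThrough : Graph m → (Fin m → Set) → Fin m → Fin m → ℕ → Set
ShortestThrough R P s t k =
  WalkThrough R P k s t × (∀ {j} → j < k → ¬ Walk R s t (suc j))

shortestThrough? : (R : Graph m) {P : Fin m → Set} → (∀ z → Dec (P z)) →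
                   ∀ s t k → Dec (ShortestThrough R P s t k)
shortestThrough? R P? s t k =
  walkThrough? R P? k s t ×-dec allUpTo? (λ j → ¬? (walk? R (suc j) s t)) k

⌊≟⌋-true : {x y : Fin n} → x ≡ y → ⌊ x ≟ y ⌋ ≡ true
⌊≟⌋-true {x = x} {y} x≡y = trans (isYes≗does (x ≟ y)) (dec-true (x ≟ y) x≡y)

⌊≟⌋-false : {x y : Fin n} → x ≢ y → ⌊ x ≟ y ⌋ ≡ false
⌊≟⌋-false {x = x} {y} x≢y = trans (isYes≗does (x ≟ y)) (dec-false (x ≟ y) x≢y)

Dist-unique : {E : Graph n} {x y : Fin n} {d d′ : ℕ} → Dist E x y d → Dist E x y d′ → d ≡ d′
Dist-unique (w , least) (w′ , least′) = ≤-antisym (least _ w′) (least′ _ w)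

module Pullback {E : Graph n} {R : Graph m} (f : Fin n → Fin m)
                (E≡R∘f : ∀ x y → E x y ≡ R (f x) (f y))
                {P : Fin m → Set} (rep : ∀ {s} → P s → Fin n)
                (f∘rep : ∀ {s} (p : P s) → f (rep p) ≡ s) where

  walk-image : {x y : Fin n} → Walk E x y k → Walk R (f x) (f y) k
  walk-image nil = nil
  walk-image (cons {x} {y} e w) = cons (trans (sym (E≡R∘f x y)) e) (walk-image w)

  lift : ∀ k {x y} → WalkThrough R P k (f x) (f y) → Walk E x y (suc k)
  lift zero    {x} {y} e = cons (trans (E≡R∘f x y) e) nil
  lift (suc k) {x} {y} (s , p , e , w) =
    cons (trans (E≡R∘f x (rep p)) (subst (Edge R (f x)) (sym (f∘rep p)) e))
         (lift k (subst (λ z → WalkThrough R P k z (f y)) (sym (f∘rep p)) w))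

  Dist-from-image : {x y : Fin n} → x ≢ y → ShortestThrough R P (f x) (f y) k → Dist E x y (suc k)
  Dist-from-image {k = k} {x} {y} x≢y (through , no-shorter) = lift k through , least
    where
      least : ∀ j → Walk E x y j → suc k ≤ j
      least zero    nil = contradiction refl x≢y
      least (suc j) w with suc k ≤? suc j
      ... | yes k<j = k<j
      ... | no  k≮j with s≤s j<k ← ≰⇒> k≮j = contradiction (walk-image w) (no-shorter j<k)

cycle-vertex₂-degree≥2 : {E : Graph n} → (∀ x y → E x y ≡ E y x) →
  ∀ k → (c : Cycle E k) → DegGe2 E (proj₁ c (# 2))
cycle-vertex₂-degree≥2 E-sym zero (f , f-inj , step , close) =
  _ , _ , (λ eq → case f-inj eq of λ ()) , trans (E-sym _ _) (step (# 1)) , close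
cycle-vertex₂-degree≥2 E-sym (suc k) (f , f-inj , step , close) =
  _ , _ , (λ eq → case f-inj eq of λ ()) , trans (E-sym _ _) (step (# 1)) , step (# 2)

-- On a cycle f 0, …, f L the walk f L, f 0, f 1, f 2 does not backtrack, and each of
-- its vertices has two distinct neighbours on the cycle.
acyclic-if-branch-walks-backtrack : {E : Graph n} (Q : Fin n → Set) →
  (∀ x y → E x y ≡ E y x) → (∀ x → DegGe2 E x → Q x) →
  (∀ {d a b c} → Q d → Q a → Q b → Q c →
     Edge E d a → Edge E a b → Edge E b c → d ≡ b ⊎ a ≡ c) →
  Acyclic E
acyclic-if-branch-walks-backtrack {E = E} Q E-sym deg⇒Q backtracks k
                                  cycle@(f , f-inj , step , close) =
  Sum.[ distinct (λ ()) , distinct (λ ()) ]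
    (backtracks (deg⇒Q _ deg-L) (deg⇒Q _ deg-0) (deg⇒Q _ deg-1)
                (deg⇒Q _ (cycle-vertex₂-degree≥2 E-sym k cycle))
                close (step (# 0)) (step (# 1)))
  where
    distinct : ∀ {i j} → i ≢ j → f i ≢ f j
    distinct i≢j fi≡fj = i≢j (f-inj fi≡fj)

    deg-0 : DegGe2 E (f (# 0))
    deg-0 = _ , _ , distinct (λ ()) , step (# 0) , trans (E-sym _ _) close
    deg-1 : DegGe2 E (f (# 1))
    deg-1 = _ , _ , distinct (λ ()) , trans (E-sym _ _) (step (# 0)) , step (# 1)
    deg-L : DegGe2 E (f (fromℕ (suc (suc k))))
    deg-L = _ , _ , distinct (λ ()) , trans (E-sym _ _) (step (fromℕ (suc k))) , close

doubleStar-pullback : {side : Fin n → Bool} {u v : Fin n} {side′ : Fin m → Bool} {u′ v′ : Fin m}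
  (f : Fin n → Fin m) →
  (∀ x → ⌊ x ≟ u ⌋ ≡ ⌊ f x ≟ u′ ⌋) → (∀ x → ⌊ x ≟ v ⌋ ≡ ⌊ f x ≟ v′ ⌋) →
  (∀ x → side x ≡ side′ (f x)) →
  ∀ x y → doubleStar side u v x y ≡ doubleStar side′ u′ v′ (f x) (f y)
doubleStar-pullback f ≟u ≟v side≡ x y
  rewrite ≟u x | ≟u y | ≟v x | ≟v y | side≡ x | side≡ y = refl

Kind : Set
Kind = Fin 6

pattern κu  = Fin.zero
pattern κv  = Fin.suc Fin.zero
pattern κv′ = Fin.suc (Fin.suc Fin.zero)
pattern κC  = Fin.suc (Fin.suc (Fin.suc Fin.zero))
pattern κA  = Fin.suc (Fin.suc (Fin.suc (Fin.suc Fin.zero)))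
pattern κB  = Fin.suc (Fin.suc (Fin.suc (Fin.suc (Fin.suc Fin.zero))))

data Spine : Kind → Set where
  spine-u  : Spine κu
  spine-v  : Spine κv
  spine-v′ : Spine κv′

spine? : ∀ s → Dec (Spine s)
spine? κu  = yes spine-u
spine? κv  = yes spine-v
spine? κv′ = yes spine-v′
spine? κC  = no λ ()
spine? κA  = no λ ()
spine? κB  = no λ ()

kindSide : Kind → Bool
kindSide κu = true
kindSide κC = true
kindSide κA = true
kindSide _  = false

starK : Graph 6
starK = doubleStar kindSide κu κv

caterpillarK : Graph 6
caterpillarK κu  κv  = true
caterpillarK κv  κu  = true
caterpillarK κv  κv′ = true
caterpillarK κv′ κv  = true
caterpillarK κu  κA  = true
caterpillarK κA  κu  = true
caterpillarK κv  κB  = true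
caterpillarK κB  κv  = true
caterpillarK κv′ κC  = true
caterpillarK κC  κv′ = true
caterpillarK _   _   = false

-- These facts are checked by evaluating decision procedures; opacity keeps every use
-- from evaluating them again.
opaque
  caterpillarK-symmetric : ∀ s t → caterpillarK s t ≡ caterpillarK t s
  caterpillarK-symmetric = from-yes (all? λ s → all? λ t → caterpillarK s t ≟ᵇ caterpillarK t s)

  caterpillarK-irreflexive : ∀ s → caterpillarK s s ≡ false
  caterpillarK-irreflexive = from-yes (all? λ s → caterpillarK s s ≟ᵇ false)

  caterpillarK-connected : ∀ s t → ∃ λ k → k < 4 × WalkThrough caterpillarK Spine k s t
  caterpillarK-connected =
    from-yes (all? λ s → all? λ t → anyUpTo? (λ k → walkThrough? caterpillarK spine? k s t) 4)

  caterpillarK-leaves : ∀ s → Spine s ⊎ ∃[ a ] (Spine a × ∀ t → Edge caterpillarK s t → t ≡ a)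
  caterpillarK-leaves =
    from-yes (all? λ s → spine? s ⊎-dec (any? λ a → spine? a ×-dec
                           all? λ t → (caterpillarK s t ≟ᵇ true) →-dec (t ≟ a)))

  caterpillarK-spine-walks-backtrack : ∀ d a b c → Spine d → Spine a → Spine b → Spine c →
    Edge caterpillarK d a → Edge caterpillarK a b → Edge caterpillarK b c → d ≡ b ⊎ a ≡ c
  caterpillarK-spine-walks-backtrack =
    from-yes (all? λ d → all? λ a → all? λ b → all? λ c →
      spine? d →-dec spine? a →-dec spine? b →-dec spine? c →-dec
      (caterpillarK d a ≟ᵇ true) →-dec (caterpillarK a b ≟ᵇ true) →-dec
      (caterpillarK b c ≟ᵇ true) →-dec
      ((d ≟ b) ⊎-dec (a ≟ c)))

data ApartFromC : Kind → Set where
  apart-u  : ApartFromC κu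
  apart-A  : ApartFromC κA
  apart-v′ : ApartFromC κv′

apartFromC? : ∀ s → Dec (ApartFromC s)
apartFromC? κu  = yes apart-u
apartFromC? κv  = no λ ()
apartFromC? κv′ = yes apart-v′
apartFromC? κC  = no λ ()
apartFromC? κA  = yes apart-A
apartFromC? κB  = no λ ()

Separated : Kind → Kind → Set
Separated s t = (s ≡ κC × ApartFromC t) ⊎ (t ≡ κC × ApartFromC s)

opaque
  distances-agree : ∀ s t → ¬ Separated s t →
    ∃ λ k → k < 3 × ShortestThrough caterpillarK Spine s t k × ShortestThrough starK Spine s t k
  distances-agree =
    from-yes (all? λ s → all? λ t →
      ¬? ((s ≟ κC ×-dec apartFromC? t) ⊎-dec (t ≟ κC ×-dec apartFromC? s)) →-dec
      anyUpTo? (λ k → shortestThrough? caterpillarK spine? s t k ×-dec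
                      shortestThrough? starK spine? s t k) 3)

module Caterpillar (side : Fin n → Bool) (u v : Fin n) (su : side u ≡ true) (sv : side v ≡ false)
                   (C : Fin n → Bool) (v′ : Fin n) (sv′ : side v′ ≡ false) (v′≢v : v′ ≢ v)
                   (C⊆U∖u : ∀ x → C x ≡ true → side x ≡ true × x ≢ u) where

  U≢V : ∀ {x y} → side x ≡ true → side y ≡ false → x ≢ y
  U≢V sx sy refl = case trans (sym sx) sy of λ ()

  kindOf : Bool → Bool → Bool → Bool → Bool → Kind
  kindOf true  _     _     _     _     = κu
  kindOf false true  _     _     _     = κv
  kindOf false false true  _     _     = κv′
  kindOf false false false true  true  = κC
  kindOf false false false true  false = κA
  kindOf false false false false _     = κB

  kind : Fin n → Kind
  kind x = kindOf ⌊ x ≟ u ⌋ ⌊ x ≟ v ⌋ ⌊ x ≟ v′ ⌋ (side x) (C x)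

  data KindOf (x : Fin n) : Kind → Set where
    is-u  : x ≡ u → KindOf x κu
    is-v  : x ≡ v → KindOf x κv
    is-v′ : x ≡ v′ → KindOf x κv′
    in-C  : C x ≡ true → KindOf x κC
    in-A  : side x ≡ true → x ≢ u → C x ≡ false → KindOf x κA
    in-B  : side x ≡ false → x ≢ v → x ≢ v′ → KindOf x κB

  classify : ∀ x → KindOf x (kind x)
  classify x with x ≟ u | x ≟ v | x ≟ v′ | side x in sx | C x in cx
  ... | yes x≡u | _       | _        | _     | _     = is-u x≡u
  ... | no _    | yes x≡v | _        | _     | _     = is-v x≡v
  ... | no _    | no _    | yes x≡v′ | _     | _     = is-v′ x≡v′
  ... | no _    | no _    | no _     | true  | true  = in-C cx
  ... | no x≢u  | no _    | no _     | true  | false = in-A sx x≢u cx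
  ... | no _    | no x≢v  | no x≢v′  | false | _     = in-B sx x≢v x≢v′

  KindOf⇒kind : ∀ {x s} → KindOf x s → kind x ≡ s
  KindOf⇒kind (is-u refl) rewrite ⌊≟⌋-true (refl {x = u}) = refl
  KindOf⇒kind (is-v refl) rewrite ⌊≟⌋-false (U≢V su sv ∘ sym) | ⌊≟⌋-true (refl {x = v}) = refl
  KindOf⇒kind (is-v′ refl)
    rewrite ⌊≟⌋-false (U≢V su sv′ ∘ sym) | ⌊≟⌋-false v′≢v | ⌊≟⌋-true (refl {x = v′}) = refl
  KindOf⇒kind {x} (in-C cx) with C⊆U∖u x cx
  ... | sx , x≢u
    rewrite ⌊≟⌋-false x≢u | ⌊≟⌋-false (U≢V sx sv) | ⌊≟⌋-false (U≢V sx sv′) | sx | cx = refl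
  KindOf⇒kind (in-A sx x≢u cx)
    rewrite ⌊≟⌋-false x≢u | ⌊≟⌋-false (U≢V sx sv) | ⌊≟⌋-false (U≢V sx sv′) | sx | cx = refl
  KindOf⇒kind (in-B sx x≢v x≢v′)
    rewrite ⌊≟⌋-false (U≢V su sx ∘ sym) | ⌊≟⌋-false x≢v | ⌊≟⌋-false x≢v′ | sx = refl

  spineVertex : ∀ {s} → Spine s → Fin n
  spineVertex spine-u  = u
  spineVertex spine-v  = v
  spineVertex spine-v′ = v′

  kind-spineVertex : ∀ {s} (p : Spine s) → kind (spineVertex p) ≡ s
  kind-spineVertex spine-u  = KindOf⇒kind (is-u refl)
  kind-spineVertex spine-v  = KindOf⇒kind (is-v refl)
  kind-spineVertex spine-v′ = KindOf⇒kind (is-v′ refl)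

  spine-fibre : ∀ {x s} → kind x ≡ s → (p : Spine s) → x ≡ spineVertex p
  spine-fibre {x} refl p = fibre p (classify x)
    where
      fibre : ∀ {s} (p : Spine s) → KindOf x s → x ≡ spineVertex p
      fibre spine-u  (is-u x≡u)   = x≡u
      fibre spine-v  (is-v x≡v)   = x≡v
      fibre spine-v′ (is-v′ x≡v′) = x≡v′

  spine-injective : ∀ {x y} → Spine (kind x) → kind x ≡ kind y → x ≡ y
  spine-injective p kx≡ky = trans (spine-fibre refl p) (sym (spine-fibre (sym kx≡ky) p))

  D : Graph n
  D = doubleStar side u v

  T : Graph n
  T = caterpillarK on kind

  D-via-kinds : ∀ x y → D x y ≡ starK (kind x) (kind y)
  D-via-kinds = doubleStar-pullback {side′ = kindSide} kind
    (λ x → ≟u (classify x)) (λ x → ≟v (classify x)) (λ x → side≡ (classify x))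
    where
      ≟u : ∀ {x s} → KindOf x s → ⌊ x ≟ u ⌋ ≡ ⌊ s ≟ κu ⌋
      ≟u (is-u x≡u)    = ⌊≟⌋-true x≡u
      ≟u (is-v refl)   = ⌊≟⌋-false (U≢V su sv ∘ sym)
      ≟u (is-v′ refl)  = ⌊≟⌋-false (U≢V su sv′ ∘ sym)
      ≟u {x} (in-C cx) = ⌊≟⌋-false (proj₂ (C⊆U∖u x cx))
      ≟u (in-A _ x≢u _) = ⌊≟⌋-false x≢u
      ≟u (in-B sx _ _) = ⌊≟⌋-false (U≢V su sx ∘ sym)

      ≟v : ∀ {x s} → KindOf x s → ⌊ x ≟ v ⌋ ≡ ⌊ s ≟ κv ⌋
      ≟v (is-u refl)   = ⌊≟⌋-false (U≢V su sv)
      ≟v (is-v x≡v)    = ⌊≟⌋-true x≡v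
      ≟v (is-v′ refl)  = ⌊≟⌋-false v′≢v
      ≟v {x} (in-C cx) = ⌊≟⌋-false (U≢V (proj₁ (C⊆U∖u x cx)) sv)
      ≟v (in-A sx _ _) = ⌊≟⌋-false (U≢V sx sv)
      ≟v (in-B _ x≢v _) = ⌊≟⌋-false x≢v

      side≡ : ∀ {x s} → KindOf x s → side x ≡ kindSide s
      side≡ (is-u refl)    = su
      side≡ (is-v refl)    = sv
      side≡ (is-v′ refl)   = sv′
      side≡ {x} (in-C cx)  = proj₁ (C⊆U∖u x cx)
      side≡ (in-A sx _ _)  = sx
      side≡ (in-B sx _ _)  = sx

  module T-pullback = Pullback {E = T} {R = caterpillarK} kind (λ _ _ → refl)
                               spineVertex kind-spineVertex
  module D-pullback = Pullback {E = D} {R = starK} kind D-via-kinds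
                               spineVertex kind-spineVertex

  T-simple : IsSimple T
  T-simple = (λ x y → caterpillarK-symmetric (kind x) (kind y)) ,
             (λ x → caterpillarK-irreflexive (kind x))

  T-connected : Connected T
  T-connected x y with caterpillarK-connected (kind x) (kind y)
  ... | k , _ , through = suc k , T-pullback.lift k through

  degree≥2⇒spine : ∀ x → DegGe2 T x → Spine (kind x)
  degree≥2⇒spine x (y , z , y≢z , x~y , x~z) with caterpillarK-leaves (kind x)
  ... | inj₁ spine = spine
  ... | inj₂ (a , p , only-a) =
    contradiction (trans (spine-fibre (only-a _ x~y) p) (sym (spine-fibre (only-a _ x~z) p))) y≢z

  T-acyclic : Acyclic T
  T-acyclic = acyclic-if-branch-walks-backtrack (Spine ∘ kind) (proj₁ T-simple) degree≥2⇒spine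
    λ pd pa pb pc d~a a~b b~c →
      Sum.map (spine-injective pd) (spine-injective pa)
              (caterpillarK-spine-walks-backtrack _ _ _ _ pd pa pb pc d~a a~b b~c)

  T-edge : ∀ {x y s t} → kind x ≡ s → kind y ≡ t → Edge caterpillarK s t → Edge T x y
  T-edge refl refl s~t = s~t

  T-realCaterpillar : ∀ {x₀ c₀} → side x₀ ≡ true → x₀ ≢ u → C x₀ ≡ false → C c₀ ≡ true →
                      IsRealCaterpillar T
  T-realCaterpillar {x₀} {c₀} sx₀ x₀≢u x₀∉C c₀∈C =
    (T-simple , T-connected , T-acyclic) ,
    u , v , v′ , U≢V su sv , U≢V su sv′ , v′≢v ∘ sym ,
    (v , x₀ , U≢V sx₀ sv ∘ sym , T-edge ku kv refl ,
     T-edge ku (KindOf⇒kind (in-A sx₀ x₀≢u x₀∉C)) refl) ,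
    (u , v′ , U≢V su sv′ , T-edge kv ku refl , T-edge kv kv′ refl) ,
    (v , c₀ , U≢V (proj₁ (C⊆U∖u c₀ c₀∈C)) sv ∘ sym , T-edge kv′ kv refl ,
     T-edge kv′ (KindOf⇒kind (in-C c₀∈C)) refl) ,
    λ x deg → spine-cases x (degree≥2⇒spine x deg)
    where
      ku = KindOf⇒kind (is-u refl)
      kv = KindOf⇒kind (is-v refl)
      kv′ = KindOf⇒kind (is-v′ refl)
      spine-cases : ∀ x → Spine (kind x) → x ≡ u ⊎ x ≡ v ⊎ x ≡ v′
      spine-cases x p with kind x | classify x | p
      ... | _ | is-u x≡u   | _ = inj₁ x≡u
      ... | _ | is-v x≡v   | _ = inj₂ (inj₁ x≡v)
      ... | _ | is-v′ x≡v′ | _ = inj₂ (inj₂ x≡v′)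
      ... | _ | in-C _     | ()
      ... | _ | in-A _ _ _ | ()
      ... | _ | in-B _ _ _ | ()

  module _ (G : Graph n) (w : Fin n → Fin n → ℕ) (G-simple : IsSimple G)
           (G⊆D : IsPartialDistanceGraph D G w) (C-component : IsComponentOf G side C)
           (v′∉N[C] : ∀ c → C c ≡ true → G v′ c ≡ false) where

    G-sym : ∀ x y → G x y ≡ G y x
    G-sym = proj₁ G-simple

    C-closed : ∀ {x y} → C x ≡ true → Edge G x y → side y ≡ true → C y ≡ true
    C-closed {x} {y} x∈C x~y sy = proj₂ (proj₂ (proj₂ C-component)) x y x∈C G[U]-edge
      where
        G[U]-edge : Edge (induced G side) x y
        G[U]-edge rewrite x~y | proj₁ (C⊆U∖u x x∈C) | sy = refl

    C-apart : ∀ {x y t} → ApartFromC t → KindOf x κC → KindOf y t → ¬ Edge G x y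
    C-apart apart-u  (in-C x∈C) (is-u refl) x~u = proj₂ (C⊆U∖u u (C-closed x∈C x~u su)) refl
    C-apart apart-A  (in-C x∈C) (in-A sy _ y∉C) x~y =
      case trans (sym (C-closed x∈C x~y sy)) y∉C of λ ()
    C-apart {x} apart-v′ (in-C x∈C) (is-v′ refl) x~v′ =
      case trans (sym x~v′) (trans (G-sym x v′) (v′∉N[C] x x∈C)) of λ ()

    edge-unseparated : ∀ {x y} → Edge G x y → ¬ Separated (kind x) (kind y)
    edge-unseparated {x} {y} x~y (inj₁ (kx≡C , apart)) =
      C-apart apart (subst (KindOf x) kx≡C (classify x)) (classify y) x~y
    edge-unseparated {x} {y} x~y (inj₂ (ky≡C , apart)) =
      C-apart apart (subst (KindOf y) ky≡C (classify y)) (classify x) (trans (G-sym y x) x~y)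

    G-edge-distinct : ∀ {x y} → Edge G x y → x ≢ y
    G-edge-distinct {x} x~x refl = case trans (sym x~x) (proj₂ G-simple x) of λ ()

    T-distances : IsPartialDistanceGraph T G w
    T-distances x y x~y =
      let k , _ , in-T , in-D = distances-agree (kind x) (kind y) (edge-unseparated x~y)
          x≢y = G-edge-distinct x~y
      in subst (Dist T x y) (Dist-unique (D-pullback.Dist-from-image x≢y in-D) (G⊆D x y x~y))
               (T-pullback.Dist-from-image x≢y in-T)

lemma2p1 : (n : ℕ) (side : Fin n → Bool) (u v : Fin n) →
    side u ≡ true → side v ≡ false →
    (G : Graph n) (w : Fin n → Fin n → ℕ) → IsSimple G →
    (∀ x y → Edge G x y → 0 < w x y) →
    IsPartialDistanceGraph (doubleStar side u v) G w →
    (C : Fin n → Bool) → IsComponentOf G side C →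
    (∀ x → C x ≡ true → side x ≡ true × x ≢ u) →
    (Σ (Fin n) λ x → side x ≡ true × x ≢ u × C x ≡ false) →
    (Σ (Fin n) λ v' → side v' ≡ false × v' ≢ v × (∀ c → C c ≡ true → G v' c ≡ false)) →
    Σ (Graph n) λ T → IsRealCaterpillar T × IsPartialDistanceGraph T G w
-- Positivity of w is implied: G is simple, so w x y is a distance between distinct vertices.
lemma2p1 n side u v su sv G w G-simple _ G⊆D C C-component C⊆U∖u
         (x₀ , sx₀ , x₀≢u , x₀∉C) (v′ , sv′ , v′≢v , v′∉N[C]) =
  T , T-realCaterpillar sx₀ x₀≢u x₀∉C (proj₂ (proj₁ (proj₂ C-component))) ,
  T-distances G w G-simple G⊆D C-component v′∉N[C]
  where open Caterpillar side u v su sv C v′ sv′ v′≢v C⊆U∖u
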